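{- Let $G$ be a $(P_2\cup P_4)$-free graph. Then $\chi(G) \leq \frac{\omega(G)^3-\omega(G)^2+2\omega(G)}{2}$.
   Context: All graphs are finite, simple and undirected. $P_n$ is the path on $n$ vertices and $P_2\cup P_4$ the disjoint union of $P_2$ and $P_4$. A graph is $P_2\cup P_4$-free if it has no induced subgraph isomorphic to $P_2\cup P_4$. $\chi$ is the chromatic number and $\omega$ the clique number. -}

module Defs where

open import Data.Nat using (ℕ; zero; suc; _+_; _*_; _∸_; _^_; _/_)
open import Data.Fin using (Fin; zero; suc)
open import Data.Bool using (Bool; true; false)
open import Data.Product using (Σ; _×_; _,_)
open import Relation.Binary.PropositionalEquality using (_≡_; _≢_)
open import Relation.Nullary using (¬_)
open import Function.Definitions using (Injective)

record Graph (n : ℕ) : Set where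
  field
    adj     : Fin n → Fin n → Bool
    sym     : ∀ u v → adj u v ≡ adj v u
    irrefl  : ∀ v → adj v v ≡ false
open Graph public

InducedSub : ∀ {k n} → Graph k → Graph n → Set
InducedSub {k} {n} H G =
  Σ (Fin k → Fin n) λ f →
    Injective _≡_ _≡_ f × (∀ i j → adj G (f i) (f j) ≡ adj H i j)

-- P₂ ∪ P₄ on vertices 0..5: edges 0–1 (the P₂) and 2–3, 3–4, 4–5 (the P₄).
p2p4-adj : Fin 6 → Fin 6 → Bool
p2p4-adj zero (suc zero) = true
p2p4-adj (suc zero) zero = true
p2p4-adj (suc (suc zero)) (suc (suc (suc zero))) = true
p2p4-adj (suc (suc (suc zero))) (suc (suc zero)) = true
p2p4-adj (suc (suc (suc zero))) (suc (suc (suc (suc zero)))) = true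
p2p4-adj (suc (suc (suc (suc zero)))) (suc (suc (suc zero))) = true
p2p4-adj (suc (suc (suc (suc zero)))) (suc (suc (suc (suc (suc zero))))) = true
p2p4-adj (suc (suc (suc (suc (suc zero))))) (suc (suc (suc (suc zero)))) = true
p2p4-adj _ _ = false

p2p4-sym : ∀ u v → p2p4-adj u v ≡ p2p4-adj v u
p2p4-sym zero zero = _≡_.refl
p2p4-sym zero (suc zero) = _≡_.refl
p2p4-sym zero (suc (suc zero)) = _≡_.refl
p2p4-sym zero (suc (suc (suc zero))) = _≡_.refl
p2p4-sym zero (suc (suc (suc (suc zero)))) = _≡_.refl
p2p4-sym zero (suc (suc (suc (suc (suc zero))))) = _≡_.refl
p2p4-sym (suc zero) zero = _≡_.refl
p2p4-sym (suc zero) (suc zero) = _≡_.refl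
p2p4-sym (suc zero) (suc (suc zero)) = _≡_.refl
p2p4-sym (suc zero) (suc (suc (suc zero))) = _≡_.refl
p2p4-sym (suc zero) (suc (suc (suc (suc zero)))) = _≡_.refl
p2p4-sym (suc zero) (suc (suc (suc (suc (suc zero))))) = _≡_.refl
p2p4-sym (suc (suc zero)) zero = _≡_.refl
p2p4-sym (suc (suc zero)) (suc zero) = _≡_.refl
p2p4-sym (suc (suc zero)) (suc (suc zero)) = _≡_.refl
p2p4-sym (suc (suc zero)) (suc (suc (suc zero))) = _≡_.refl
p2p4-sym (suc (suc zero)) (suc (suc (suc (suc zero)))) = _≡_.refl
p2p4-sym (suc (suc zero)) (suc (suc (suc (suc (suc zero))))) = _≡_.refl
p2p4-sym (suc (suc (suc zero))) zero = _≡_.refl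
p2p4-sym (suc (suc (suc zero))) (suc zero) = _≡_.refl
p2p4-sym (suc (suc (suc zero))) (suc (suc zero)) = _≡_.refl
p2p4-sym (suc (suc (suc zero))) (suc (suc (suc zero))) = _≡_.refl
p2p4-sym (suc (suc (suc zero))) (suc (suc (suc (suc zero)))) = _≡_.refl
p2p4-sym (suc (suc (suc zero))) (suc (suc (suc (suc (suc zero))))) = _≡_.refl
p2p4-sym (suc (suc (suc (suc zero)))) zero = _≡_.refl
p2p4-sym (suc (suc (suc (suc zero)))) (suc zero) = _≡_.refl
p2p4-sym (suc (suc (suc (suc zero)))) (suc (suc zero)) = _≡_.refl
p2p4-sym (suc (suc (suc (suc zero)))) (suc (suc (suc zero))) = _≡_.refl
p2p4-sym (suc (suc (suc (suc zero)))) (suc (suc (suc (suc zero)))) = _≡_.refl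
p2p4-sym (suc (suc (suc (suc zero)))) (suc (suc (suc (suc (suc zero))))) = _≡_.refl
p2p4-sym (suc (suc (suc (suc (suc zero))))) zero = _≡_.refl
p2p4-sym (suc (suc (suc (suc (suc zero))))) (suc zero) = _≡_.refl
p2p4-sym (suc (suc (suc (suc (suc zero))))) (suc (suc zero)) = _≡_.refl
p2p4-sym (suc (suc (suc (suc (suc zero))))) (suc (suc (suc zero))) = _≡_.refl
p2p4-sym (suc (suc (suc (suc (suc zero))))) (suc (suc (suc (suc zero)))) = _≡_.refl
p2p4-sym (suc (suc (suc (suc (suc zero))))) (suc (suc (suc (suc (suc zero))))) = _≡_.refl

p2p4-irrefl : ∀ v → p2p4-adj v v ≡ false
p2p4-irrefl zero = _≡_.refl
p2p4-irrefl (suc zero) = _≡_.refl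
p2p4-irrefl (suc (suc zero)) = _≡_.refl
p2p4-irrefl (suc (suc (suc zero))) = _≡_.refl
p2p4-irrefl (suc (suc (suc (suc zero)))) = _≡_.refl
p2p4-irrefl (suc (suc (suc (suc (suc zero))))) = _≡_.refl

P2∪P4 : Graph 6
P2∪P4 = record { adj = p2p4-adj ; sym = p2p4-sym ; irrefl = p2p4-irrefl }

P2∪P4-free : ∀ {n} → Graph n → Set
P2∪P4-free G = ¬ InducedSub P2∪P4 G

HasClique : ∀ {n} → Graph n → ℕ → Set
HasClique {n} G k =
  Σ (Fin k → Fin n) λ f →
    Injective _≡_ _≡_ f × (∀ i j → i ≢ j → adj G (f i) (f j) ≡ true)

CliqueNumber : ∀ {n} → Graph n → ℕ → Set
CliqueNumber G w = HasClique G w × ¬ HasClique G (suc w)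

Colouring : ∀ {n} → Graph n → ℕ → Set
Colouring {n} G c =
  Σ (Fin n → Fin c) λ col → ∀ u v → adj G u v ≡ true → col u ≢ col v

χ≤ : ∀ {n} → Graph n → ℕ → Set
χ≤ G c = Colouring G c

-- (ω³ − ω² + 2ω) / 2   (the numerator is always even, so this is exact)
bound : ℕ → ℕ
bound w = (w ^ 3 ∸ w ^ 2 + 2 * w) / 2

-- Fix a maximum clique K = {k₀, …, k_{ω-1}}. For each of the ω(ω-1)/2 pairs {kᵢ, kⱼ},
-- the vertices adjacent to neither induce a P₄-free graph, since a P₄ among them
-- together with the edge kᵢkⱼ would be an induced P₂ ∪ P₄. P₄-free graphs are
-- perfect (by Seinsche's theorem the graph or its complement is disconnected, and
-- χ = ω follows inductively), so each such set gets ω colours of its own palette.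
-- Every other vertex misses at most one vertex of K, and exactly one by maximality;
-- it receives the colour of that index, which is proper because two adjacent such
-- vertices missing the same kᵢ, together with K ∖ kᵢ, would form an (ω+1)-clique.
-- This uses ω · ω(ω-1)/2 + ω = (ω³ - ω² + 2ω)/2 colours.

module Submission where

open import Defs hiding (sym)
open import Data.Bool using (Bool; true; false; not)
open import Data.Bool.Properties using (¬-not; not-¬; not-involutive) renaming (_≟_ to _≟ᵇ_)
open import Data.Empty using (⊥-elim)
open import Data.Fin using (Fin; zero; suc; _↑ˡ_; _↑ʳ_; splitAt; join; inject≤; combine; punchIn)
open import Data.Fin.Properties
  using (_≟_; all?; any?; suc-injective; ↑ˡ-injective; ↑ʳ-injective; splitAt-↑ˡ; splitAt-↑ʳ;
         join-splitAt; inject≤-injective; combine-injective; punchIn-injective; punchInᵢ≢i)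
open import Data.List using (List; []; _∷_; length; filter; allFin)
open import Data.List.Membership.Propositional using (_∈_; find; lose)
open import Data.List.Membership.Propositional.Properties using (∈-filter⁺; ∈-filter⁻; ∈-allFin)
open import Data.List.Properties using (filter-notAll)
open import Data.List.Relation.Binary.Subset.Propositional using (_⊆_)
open import Data.List.Relation.Binary.Subset.Propositional.Properties using (filter-⊆)
open import Data.List.Relation.Unary.All as All using (All; []; _∷_)
open import Data.List.Relation.Unary.Any as Any using (here; there)
open import Data.List.Relation.Unary.Unique.Propositional using (Unique; []; _∷_)
open import Data.List.Relation.Unary.Unique.Propositional.Properties using (allFin⁺)
  renaming (filter⁺ to unique-filter)
open import Data.Nat using (ℕ; zero; suc; _+_; _*_; _∸_; _^_; _/_; _≤_; _<_; _≤?_)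
open import Data.Nat.DivMod using (m*n/n≡m)
open import Data.Nat.Induction using (<-wellFounded)
open import Data.Nat.Properties using (≤-total; ≰⇒>; m+n∸n≡m)
open import Data.Nat.Tactic.RingSolver using (solve-∀)
open import Data.Product as Product using (∃-syntax; _×_; _,_; proj₁; proj₂)
open import Data.Sum as Sum using (_⊎_; inj₁; inj₂; [_,_]′)
open import Data.Unit using (tt)
import Data.Vec.Functional as Vec
open import Function using (_∘_; _on_)
open import Function.Definitions using (Injective)
open import Induction.WellFounded using (Acc; acc)
import Relation.Binary.Construct.On as On
open import Relation.Binary.PropositionalEquality
  using (_≡_; _≢_; refl; sym; trans; cong; subst; module ≡-Reasoning)
open import Relation.Nullary
  using (¬_; Dec; yes; no; contradiction; ¬?; _×-dec_; _⊎-dec_; _→-dec_; decidable-stable; toWitness)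
open import Relation.Unary using (Pred; Decidable)
open import Level using (0ℓ)

all-or-counterexample : ∀ {A : Set} {Q : Pred A 0ℓ} → Decidable Q → (f : A → Bool) (γ : Bool) (L : List A) →
  (∀ {b} → b ∈ L → Q b → f b ≡ γ) ⊎ (∃[ b ] b ∈ L × Q b × f b ≢ γ)
all-or-counterexample Q? f γ L with Any.any? (λ b → Q? b ×-dec ¬? (f b ≟ᵇ γ)) L
... | yes found = inj₂ (find found)
... | no none = inj₁ λ {b} b∈ qb → decidable-stable (f b ≟ᵇ γ) λ fb≢γ → none (lose b∈ (qb , fb≢γ))

↑ˡ≢↑ʳ : ∀ {m n} (i : Fin m) (j : Fin n) → i ↑ˡ n ≢ m ↑ʳ j
↑ˡ≢↑ʳ {m} {n} i j eq =
  contradiction (trans (sym (splitAt-↑ˡ m i n)) (trans (cong (splitAt m) eq) (splitAt-↑ʳ m n j))) λ ()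

splitAt-injective : ∀ m {n} → Injective _≡_ _≡_ (splitAt m {n})
splitAt-injective m {n} {i} {j} eq =
  trans (sym (join-splitAt m n i)) (trans (cong (join m n) eq) (join-splitAt m n j))

TwinFree : ∀ {k} → Graph k → Set
TwinFree {k} H = ∀ (i j : Fin k) → (∀ l → adj H i l ≡ adj H j l) → i ≡ j

P2∪P4-twin-free : TwinFree P2∪P4
P2∪P4-twin-free =
  toWitness {a? = all? λ i → all? λ j → all? (λ l → adj P2∪P4 i l ≟ᵇ adj P2∪P4 j l) →-dec i ≟ j} _

module _ {n : ℕ} (G : Graph n) where

  adj-sym : ∀ u v → adj G u v ≡ adj G v u
  adj-sym = Graph.sym G

  adj⇒≢ : ∀ {u v} → adj G u v ≡ true → u ≢ v
  adj⇒≢ {u} uv refl = contradiction (trans (sym uv) (irrefl G u)) λ ()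

  IsClique : ∀ {I : Set} → (I → Fin n) → Set
  IsClique {I} f = ∀ (i j : I) → i ≢ j → adj G (f i) (f j) ≡ true

  clique-∘ : ∀ {I J : Set} {f : I → Fin n} {g : J → I} → IsClique f → Injective _≡_ _≡_ g → IsClique (f ∘ g)
  clique-∘ f-clique g-injective i j i≢j = f-clique _ _ (i≢j ∘ g-injective)

  ∷-clique : ∀ {k v} {f : Fin k → Fin n} → IsClique f → (∀ i → adj G v (f i) ≡ true) → IsClique (v Vec.∷ f)
  ∷-clique f-clique v~f zero    zero    0≢0 = contradiction refl 0≢0
  ∷-clique f-clique v~f zero    (suc j) _   = v~f j
  ∷-clique f-clique v~f (suc i) zero    _   = trans (adj-sym _ _) (v~f i)
  ∷-clique f-clique v~f (suc i) (suc j) i≢j = f-clique i j (i≢j ∘ cong suc)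

  clique⇒HasClique : ∀ {k} {f : Fin k → Fin n} → IsClique f → HasClique G k
  clique⇒HasClique {f = f} f-clique = f , injective , f-clique
    where
    injective : Injective _≡_ _≡_ f
    injective {i} {j} fi≡fj with i ≟ j
    ... | yes i≡j = i≡j
    ... | no i≢j = contradiction fi≡fj (adj⇒≢ (f-clique i j i≢j))

  clique-size-≤ : ∀ {ω k} {f : Fin k → Fin n} → ¬ HasClique G (suc ω) → IsClique f → k ≤ ω
  clique-size-≤ {ω} {k} {f} no-clique f-clique with k ≤? ω
  ... | yes k≤ω = k≤ω
  ... | no k≰ω = contradiction (clique⇒HasClique restricted) no-clique
    where
    restricted : IsClique (λ i → f (inject≤ i (≰⇒> k≰ω)))
    restricted = clique-∘ f-clique (inject≤-injective (≰⇒> k≰ω) (≰⇒> k≰ω) _ _)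

  replace-by-edge : ∀ {k} {K : Fin k → Fin n} → IsClique K → ∀ i {u v} → adj G u v ≡ true →
    (∀ j → j ≢ i → adj G u (K j) ≡ true) → (∀ j → j ≢ i → adj G v (K j) ≡ true) → HasClique G (suc k)
  replace-by-edge {zero} _ ()
  replace-by-edge {suc k} {K} K-clique i {u} {v} uv u~K v~K =
    clique⇒HasClique (∷-clique (∷-clique K∖i-clique v~K∖i) u~v∷K∖i)
    where
    K∖i-clique : IsClique (K ∘ punchIn i)
    K∖i-clique = clique-∘ K-clique (punchIn-injective i _ _)
    v~K∖i : ∀ j → adj G v (K (punchIn i j)) ≡ true
    v~K∖i j = v~K (punchIn i j) (punchInᵢ≢i i j)
    u~v∷K∖i : ∀ j → adj G u ((v Vec.∷ K ∘ punchIn i) j) ≡ true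
    u~v∷K∖i zero    = uv
    u~v∷K∖i (suc j) = u~K (punchIn i j) (punchInᵢ≢i i j)

  -- An induced path a–b–c–d in the graph whose non-edges are the pairs with adjacency
  -- value β: in G itself for β = false, in its complement for β = true.
  InducedP4 : Bool → (a b c d : Fin n) → Set
  InducedP4 β a b c d =
    adj G a b ≡ not β × adj G b c ≡ not β × adj G c d ≡ not β ×
    adj G a c ≡ β × adj G a d ≡ β × adj G b d ≡ β

  P4-free : List (Fin n) → Set
  P4-free S = ∀ {a b c d} → a ∈ S → b ∈ S → c ∈ S → d ∈ S → ¬ InducedP4 false a b c d

  P4-free-⊆ : ∀ {S T} → T ⊆ S → P4-free S → P4-free T
  P4-free-⊆ T⊆S free a∈ b∈ c∈ d∈ = free (T⊆S a∈) (T⊆S b∈) (T⊆S c∈) (T⊆S d∈)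

  complement-P4 : ∀ {a b c d} → InducedP4 true a b c d → InducedP4 false c a d b
  complement-P4 {a} {b} {c} {d} (ab , bc , cd , ac , ad , bd) =
    trans (adj-sym c a) ac , ad , trans (adj-sym d b) bd , cd , trans (adj-sym c b) bc , ab

  P4-free⇒¬InducedP4 : ∀ {S} → P4-free S → ∀ β {a b c d} →
    a ∈ S → b ∈ S → c ∈ S → d ∈ S → ¬ InducedP4 β a b c d
  P4-free⇒¬InducedP4 free false a∈ b∈ c∈ d∈ = free a∈ b∈ c∈ d∈
  P4-free⇒¬InducedP4 free true  a∈ b∈ c∈ d∈ = free c∈ a∈ d∈ b∈ ∘ complement-P4

  Subsingleton : List (Fin n) → Set
  Subsingleton S = ∀ {a b} → a ∈ S → b ∈ S → a ≡ b

  -- A partition of S into two nonempty sides between which every pair has adjacency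
  -- value β: G[S] is disconnected for β = false, its complement for β = true.
  record Split (β : Bool) (S : List (Fin n)) : Set₁ where
    field
      Side    : Pred (Fin n) 0ℓ
      side?   : Decidable Side
      inside  : ∃[ a ] a ∈ S × Side a
      outside : ∃[ b ] b ∈ S × ¬ Side b
      cross   : ∀ {a b} → a ∈ S → Side a → b ∈ S → ¬ Side b → adj G a b ≡ β

    ¬side? : Decidable (λ v → ¬ Side v)
    ¬side? v = ¬? (side? v)

    inner : List (Fin n)
    inner = filter side? S

    outer : List (Fin n)
    outer = filter ¬side? S

    inner-shorter : length inner < length S
    inner-shorter = let b , b∈ , ¬sb = outside in filter-notAll side? S (lose b∈ ¬sb)

    outer-shorter : length outer < length S
    outer-shorter = let a , a∈ , sa = inside in filter-notAll ¬side? S (lose a∈ λ ¬sa → ¬sa sa)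

    cover : ∀ {v} → v ∈ S → v ∈ inner ⊎ v ∈ outer
    cover {v} v∈ with side? v
    ... | yes sv  = inj₁ (∈-filter⁺ side? v∈ sv)
    ... | no ¬sv = inj₂ (∈-filter⁺ ¬side? v∈ ¬sv)

    inner×outer : ∀ {a b} → a ∈ inner → b ∈ outer → adj G a b ≡ β
    inner×outer a∈ b∈ =
      let a∈S , sa = ∈-filter⁻ side? a∈ ; b∈S , ¬sb = ∈-filter⁻ ¬side? b∈ in cross a∈S sa b∈S ¬sb

  flip-split : ∀ {β S} → Split β S → Split β S
  flip-split s = record
    { Side    = λ w → ¬ Side w
    ; side?   = ¬side?
    ; inside  = outside
    ; outside = let a , a∈ , sa = inside in a , a∈ , λ ¬sa → ¬sa sa
    ; cross   = λ {a} {b} a∈ ¬sa b∈ ¬¬sb →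
        trans (adj-sym a b) (cross b∈ (decidable-stable (side? b) ¬¬sb) a∈ ¬sa)
    }
    where open Split s

  module _ {v : Fin n} {S : List (Fin n)} (v∉S : All (v ≢_) S) where

    private
      ≢v : ∀ {w} → w ∈ S → w ≢ v
      ≢v w∈ refl = All.lookup v∉S w∈ refl

    isolate : ∀ {γ} → (∃[ x ] x ∈ S) → (∀ {w} → w ∈ S → adj G v w ≡ γ) → Split γ (v ∷ S)
    isolate (x , x∈) v~S = record
      { Side    = _≡ v
      ; side?   = _≟ v
      ; inside  = v , here refl , refl
      ; outside = x , there x∈ , ≢v x∈
      ; cross   = λ where
          (here refl) _ (here refl) b≢v → contradiction refl b≢v
          (here refl) _ (there b∈)  _   → v~S b∈
          (there a∈)  refl _ _          → contradiction refl (≢v a∈)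
      }

    attach : ∀ {β} (s : Split β S) → (∀ {b} → b ∈ S → ¬ Split.Side s b → adj G v b ≡ β) → Split β (v ∷ S)
    attach s v~outside = record
      { Side    = λ w → w ≡ v ⊎ Side w
      ; side?   = λ w → (w ≟ v) ⊎-dec side? w
      ; inside  = v , here refl , inj₁ refl
      ; outside = let b , b∈ , ¬sb = outside in b , there b∈ , [ ≢v b∈ , ¬sb ]′
      ; cross   = λ where
          _ _ (here refl) ¬sb                 → contradiction (inj₁ refl) ¬sb
          (here refl) _ (there b∈) ¬sb        → v~outside b∈ (¬sb ∘ inj₂)
          (there a∈) (inj₁ refl) (there _) _  → contradiction refl (≢v a∈)
          (there a∈) (inj₂ sa) (there b∈) ¬sb → cross a∈ sa b∈ (¬sb ∘ inj₂)
      }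
      where open Split s

    module _ (free : P4-free (v ∷ S)) {β} (s : Split β S) where
      open Split s

      -- If a on the new side and b off it had adjacency value not β, then b–a–v–w
      -- would be an induced P₄ in G or in its complement.
      separate : (∃[ a ] a ∈ S × Side a × adj G v a ≢ β) → (∃[ b ] b ∈ S × ¬ Side b × adj G v b ≢ β) →
                 (∃[ x ] x ∈ S × adj G v x ≢ not β) → Split β (v ∷ S)
      separate (a₁ , a₁∈ , sa₁ , va₁) (b₁ , b₁∈ , ¬sb₁ , vb₁) (x , x∈ , vx) = record
        { Side    = Side′
        ; side?   = λ w → (w ≟ v) ⊎-dec (adj G v w ≟ᵇ not β)
        ; inside  = v , here refl , inj₁ refl
        ; outside = x , there x∈ , [ ≢v x∈ , vx ]′
        ; cross   = cross′
        }
        where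
        Side′ : Pred (Fin n) 0ℓ
        Side′ w = w ≡ v ⊎ adj G v w ≡ not β

        v~outside : ∀ {b} → ¬ Side′ b → adj G v b ≡ β
        v~outside ¬sb = trans (¬-not (¬sb ∘ inj₂)) (not-involutive β)

        common-non-neighbour : ∀ {a b} → a ∈ S → b ∈ S → adj G a b ≡ not β →
          ∃[ w ] w ∈ S × adj G v w ≡ not β × adj G a w ≡ β × adj G b w ≡ β
        common-non-neighbour {a} {b} a∈ b∈ ab with side? a | side? b
        ... | yes sa | yes sb = b₁ , b₁∈ , ¬-not vb₁ , cross a∈ sa b₁∈ ¬sb₁ , cross b∈ sb b₁∈ ¬sb₁
        ... | no ¬sa | no ¬sb =
          a₁ , a₁∈ , ¬-not va₁ , trans (adj-sym a a₁) (cross a₁∈ sa₁ a∈ ¬sa) ,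
          trans (adj-sym b a₁) (cross a₁∈ sa₁ b∈ ¬sb)
        ... | yes sa | no ¬sb = ⊥-elim (not-¬ (cross a∈ sa b∈ ¬sb) ab)
        ... | no ¬sa | yes sb = ⊥-elim (not-¬ (trans (adj-sym a b) (cross b∈ sb a∈ ¬sa)) ab)

        cross′ : ∀ {a b} → a ∈ v ∷ S → Side′ a → b ∈ v ∷ S → ¬ Side′ b → adj G a b ≡ β
        cross′ _ (inj₁ refl) _ ¬sb = v~outside ¬sb
        cross′ {a} {b} a∈ (inj₂ va) b∈ ¬sb with adj G a b ≟ᵇ β
        ... | yes ab≡β = ab≡β
        ... | no ab≢β = ⊥-elim (no-P4 (common-non-neighbour a∈S b∈S ab))
          where
          ab : adj G a b ≡ not β
          ab = ¬-not ab≢β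
          vb : adj G v b ≡ β
          vb = v~outside ¬sb
          a∈S : a ∈ S
          a∈S = Any.tail (λ { refl → ab≢β vb }) a∈
          b∈S : b ∈ S
          b∈S = Any.tail (¬sb ∘ inj₁) b∈
          no-P4 : ¬ (∃[ w ] w ∈ S × adj G v w ≡ not β × adj G a w ≡ β × adj G b w ≡ β)
          no-P4 (w , w∈ , vw , aw , bw) =
            P4-free⇒¬InducedP4 free β b∈ a∈ (here refl) (there w∈)
              (trans (adj-sym b a) ab , trans (adj-sym a v) va , vw , trans (adj-sym b v) vb , bw , aw)

      extend : ∃[ γ ] Split γ (v ∷ S)
      extend with all-or-counterexample ¬side? (adj G v) β S
                | all-or-counterexample side? (adj G v) β S
                | all-or-counterexample (λ _ → yes tt) (adj G v) (not β) S
      ... | inj₁ v~outside | _ | _ = β , attach s v~outside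
      ... | inj₂ _ | inj₁ v~inside | _ =
        β , attach (flip-split s) λ {b} b∈ ¬¬sb → v~inside b∈ (decidable-stable (side? b) ¬¬sb)
      ... | inj₂ _ | inj₂ _ | inj₁ v≁S = not β , isolate (Product.map₂ proj₁ inside) (λ w∈ → v≁S w∈ tt)
      ... | inj₂ b₁ | inj₂ a₁ | inj₂ (x , x∈ , _ , vx) = β , separate a₁ b₁ (x , x∈ , vx)

  add-to-subsingleton : ∀ {v S} → All (v ≢_) S → Subsingleton S →
    (∃[ β ] Split β (v ∷ S)) ⊎ Subsingleton (v ∷ S)
  add-to-subsingleton {S = []} _ _ = inj₂ λ { (here refl) (here refl) → refl }
  add-to-subsingleton {v} {x ∷ S} v∉S subsingleton =
    inj₁ (adj G v x , isolate v∉S (x , here refl) λ w∈ → cong (adj G v) (subsingleton w∈ (here refl)))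

  split-or-subsingleton : ∀ {S} → Unique S → P4-free S → (∃[ β ] Split β S) ⊎ Subsingleton S
  split-or-subsingleton [] _ = inj₂ λ ()
  split-or-subsingleton (v∉S ∷ unique) free with split-or-subsingleton unique (P4-free-⊆ there free)
  ... | inj₁ (β , s)      = inj₁ (extend v∉S free s)
  ... | inj₂ subsingleton = add-to-subsingleton v∉S subsingleton

  -- A certificate that χ(G[S]) = ω(G[S]).
  record OptimalColouring (S : List (Fin n)) : Set where
    field
      colours         : ℕ
      colour          : ∀ {v} → v ∈ S → Fin colours
      proper          : ∀ {u v} (u∈ : u ∈ S) (v∈ : v ∈ S) → adj G u v ≡ true → colour u∈ ≢ colour v∈
      clique          : Fin colours → Fin n
      clique-isClique : IsClique clique
      clique⊆         : ∀ i → clique i ∈ S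

  open OptimalColouring

  subsingleton-colouring : ∀ {S} → Subsingleton S → OptimalColouring S
  subsingleton-colouring {[]} _ = record
    { colours = 0 ; colour = λ () ; proper = λ () ; clique = λ () ; clique-isClique = λ () ; clique⊆ = λ () }
  subsingleton-colouring {x ∷ _} subsingleton = record
    { colours         = 1
    ; colour          = λ _ → zero
    ; proper          = λ u∈ v∈ uv _ → adj⇒≢ uv (subsingleton u∈ v∈)
    ; clique          = λ _ → x
    ; clique-isClique = λ { zero zero 0≢0 → contradiction refl 0≢0 }
    ; clique⊆         = λ _ → here refl
    }

  module _ {S A B : List (Fin n)} (cover : ∀ {v} → v ∈ S → v ∈ A ⊎ v ∈ B) (A⊆S : A ⊆ S) (B⊆S : B ⊆ S)
           (χA : OptimalColouring A) (χB : OptimalColouring B) where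

    private
      module A = OptimalColouring χA
      module B = OptimalColouring χB

    union-colouring≤ : A.colours ≤ B.colours → (∀ {a b} → a ∈ A → b ∈ B → adj G a b ≡ false) →
      OptimalColouring S
    union-colouring≤ A≤B anticomplete = record
      { colours         = B.colours
      ; colour          = λ v∈ → colour′ (cover v∈)
      ; proper          = λ u∈ v∈ → proper′ (cover u∈) (cover v∈)
      ; clique          = B.clique
      ; clique-isClique = B.clique-isClique
      ; clique⊆         = B⊆S ∘ B.clique⊆
      }
      where
      colour′ : ∀ {v} → v ∈ A ⊎ v ∈ B → Fin B.colours
      colour′ (inj₁ a∈) = inject≤ (A.colour a∈) A≤B
      colour′ (inj₂ b∈) = B.colour b∈

      proper′ : ∀ {u v} (u∈ : u ∈ A ⊎ u ∈ B) (v∈ : v ∈ A ⊎ v ∈ B) → adj G u v ≡ true → colour′ u∈ ≢ colour′ v∈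
      proper′ (inj₁ u∈) (inj₁ v∈) uv = A.proper u∈ v∈ uv ∘ inject≤-injective A≤B A≤B _ _
      proper′ (inj₂ u∈) (inj₂ v∈) uv = B.proper u∈ v∈ uv
      proper′ (inj₁ u∈) (inj₂ v∈) uv _ = contradiction (trans (sym uv) (anticomplete u∈ v∈)) λ ()
      proper′ {u} {v} (inj₂ u∈) (inj₁ v∈) uv _ =
        contradiction (trans (sym uv) (trans (adj-sym u v) (anticomplete v∈ u∈))) λ ()

    join-colouring : (∀ {a b} → a ∈ A → b ∈ B → adj G a b ≡ true) → OptimalColouring S
    join-colouring complete = record
      { colours         = A.colours + B.colours
      ; colour          = λ v∈ → colour′ (cover v∈)
      ; proper          = λ u∈ v∈ → proper′ (cover u∈) (cover v∈)
      ; clique          = clique′ ∘ splitAt A.colours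
      ; clique-isClique = clique-∘ clique′-isClique (splitAt-injective A.colours)
      ; clique⊆         = clique′⊆ ∘ splitAt A.colours
      }
      where
      colour′ : ∀ {v} → v ∈ A ⊎ v ∈ B → Fin (A.colours + B.colours)
      colour′ (inj₁ a∈) = A.colour a∈ ↑ˡ B.colours
      colour′ (inj₂ b∈) = A.colours ↑ʳ B.colour b∈

      proper′ : ∀ {u v} (u∈ : u ∈ A ⊎ u ∈ B) (v∈ : v ∈ A ⊎ v ∈ B) → adj G u v ≡ true → colour′ u∈ ≢ colour′ v∈
      proper′ (inj₁ u∈) (inj₁ v∈) uv = A.proper u∈ v∈ uv ∘ ↑ˡ-injective B.colours _ _
      proper′ (inj₂ u∈) (inj₂ v∈) uv = B.proper u∈ v∈ uv ∘ ↑ʳ-injective A.colours _ _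
      proper′ (inj₁ _)  (inj₂ _)  _  = ↑ˡ≢↑ʳ _ _
      proper′ (inj₂ _)  (inj₁ _)  _  = ↑ˡ≢↑ʳ _ _ ∘ sym

      clique′ : Fin A.colours ⊎ Fin B.colours → Fin n
      clique′ = [ A.clique , B.clique ]′

      clique′-isClique : IsClique clique′
      clique′-isClique (inj₁ i) (inj₁ j) i≢j = A.clique-isClique i j (i≢j ∘ cong inj₁)
      clique′-isClique (inj₂ i) (inj₂ j) i≢j = B.clique-isClique i j (i≢j ∘ cong inj₂)
      clique′-isClique (inj₁ i) (inj₂ j) _   = complete (A.clique⊆ i) (B.clique⊆ j)
      clique′-isClique (inj₂ i) (inj₁ j) _   = trans (adj-sym _ _) (complete (A.clique⊆ j) (B.clique⊆ i))

      clique′⊆ : ∀ x → clique′ x ∈ S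
      clique′⊆ (inj₁ i) = A⊆S (A.clique⊆ i)
      clique′⊆ (inj₂ j) = B⊆S (B.clique⊆ j)

  union-colouring : ∀ {S A B} → (∀ {v} → v ∈ S → v ∈ A ⊎ v ∈ B) → A ⊆ S → B ⊆ S →
    OptimalColouring A → OptimalColouring B → (∀ {a b} → a ∈ A → b ∈ B → adj G a b ≡ false) →
    OptimalColouring S
  union-colouring cover A⊆S B⊆S χA χB anticomplete with ≤-total (colours χA) (colours χB)
  ... | inj₁ A≤B = union-colouring≤ cover A⊆S B⊆S χA χB A≤B anticomplete
  ... | inj₂ B≤A = union-colouring≤ (Sum.swap ∘ cover) B⊆S A⊆S χB χA B≤A
                     λ b∈ a∈ → trans (adj-sym _ _) (anticomplete a∈ b∈)

  split-colouring : ∀ {β S} (s : Split β S) →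
    OptimalColouring (Split.inner s) → OptimalColouring (Split.outer s) → OptimalColouring S
  split-colouring {false} s χA χB =
    union-colouring (Split.cover s) (filter-⊆ _ _) (filter-⊆ _ _) χA χB (Split.inner×outer s)
  split-colouring {true} s χA χB =
    join-colouring (Split.cover s) (filter-⊆ _ _) (filter-⊆ _ _) χA χB (Split.inner×outer s)

  cograph-colouring : ∀ {S} → Unique S → P4-free S → Acc (_<_ on length) S → OptimalColouring S
  cograph-colouring unique free (acc shorter) with split-or-subsingleton unique free
  ... | inj₂ subsingleton = subsingleton-colouring subsingleton
  ... | inj₁ (β , s) = split-colouring s
          (cograph-colouring (unique-filter side? unique) (P4-free-⊆ (filter-⊆ side? _) free)
            (shorter inner-shorter))
          (cograph-colouring (unique-filter ¬side? unique) (P4-free-⊆ (filter-⊆ ¬side? _) free)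
            (shorter outer-shorter))
    where open Split s

  adjacency-preserving-injective : ∀ {k} {H : Graph k} {f : Fin k → Fin n} → TwinFree H →
    (∀ i j → adj G (f i) (f j) ≡ adj H i j) → Injective _≡_ _≡_ f
  adjacency-preserving-injective {H = H} {f} twin-free preserves {i} {j} fi≡fj = twin-free i j λ l →
    begin
      adj H i l          ≡⟨ sym (preserves i l) ⟩
      adj G (f i) (f l)  ≡⟨ cong (λ x → adj G x (f l)) fi≡fj ⟩
      adj G (f j) (f l)  ≡⟨ preserves j l ⟩
      adj H j l
    ∎
    where open ≡-Reasoning

  P2∪P4-induced : ∀ {x y a b c d} → adj G x y ≡ true →
    All (λ w → adj G x w ≡ false × adj G y w ≡ false) (a ∷ b ∷ c ∷ d ∷ []) →
    InducedP4 false a b c d → InducedSub P2∪P4 G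
  P2∪P4-induced {x} {y} {a} {b} {c} {d} xy ((xa , ya) ∷ (xb , yb) ∷ (xc , yc) ∷ (xd , yd) ∷ [])
                (ab , bc , cd , ac , ad , bd) =
    f , adjacency-preserving-injective {H = P2∪P4} {f = f} P2∪P4-twin-free preserves , preserves
    where
    f : Fin 6 → Fin n
    f zero                                = x
    f (suc zero)                          = y
    f (suc (suc zero))                    = a
    f (suc (suc (suc zero)))              = b
    f (suc (suc (suc (suc zero))))        = c
    f (suc (suc (suc (suc (suc zero))))) = d

    preserves : ∀ i j → adj G (f i) (f j) ≡ adj P2∪P4 i j
    preserves zero zero = irrefl G x
    preserves zero (suc zero) = xy
    preserves zero (suc (suc zero)) = xa
    preserves zero (suc (suc (suc zero))) = xb
    preserves zero (suc (suc (suc (suc zero)))) = xc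
    preserves zero (suc (suc (suc (suc (suc zero))))) = xd
    preserves (suc zero) zero = trans (adj-sym y x) xy
    preserves (suc zero) (suc zero) = irrefl G y
    preserves (suc zero) (suc (suc zero)) = ya
    preserves (suc zero) (suc (suc (suc zero))) = yb
    preserves (suc zero) (suc (suc (suc (suc zero)))) = yc
    preserves (suc zero) (suc (suc (suc (suc (suc zero))))) = yd
    preserves (suc (suc zero)) zero = trans (adj-sym a x) xa
    preserves (suc (suc zero)) (suc zero) = trans (adj-sym a y) ya
    preserves (suc (suc zero)) (suc (suc zero)) = irrefl G a
    preserves (suc (suc zero)) (suc (suc (suc zero))) = ab
    preserves (suc (suc zero)) (suc (suc (suc (suc zero)))) = ac
    preserves (suc (suc zero)) (suc (suc (suc (suc (suc zero))))) = ad
    preserves (suc (suc (suc zero))) zero = trans (adj-sym b x) xb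
    preserves (suc (suc (suc zero))) (suc zero) = trans (adj-sym b y) yb
    preserves (suc (suc (suc zero))) (suc (suc zero)) = trans (adj-sym b a) ab
    preserves (suc (suc (suc zero))) (suc (suc (suc zero))) = irrefl G b
    preserves (suc (suc (suc zero))) (suc (suc (suc (suc zero)))) = bc
    preserves (suc (suc (suc zero))) (suc (suc (suc (suc (suc zero))))) = bd
    preserves (suc (suc (suc (suc zero)))) zero = trans (adj-sym c x) xc
    preserves (suc (suc (suc (suc zero)))) (suc zero) = trans (adj-sym c y) yc
    preserves (suc (suc (suc (suc zero)))) (suc (suc zero)) = trans (adj-sym c a) ac
    preserves (suc (suc (suc (suc zero)))) (suc (suc (suc zero))) = trans (adj-sym c b) bc
    preserves (suc (suc (suc (suc zero)))) (suc (suc (suc (suc zero)))) = irrefl G c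
    preserves (suc (suc (suc (suc zero)))) (suc (suc (suc (suc (suc zero))))) = cd
    preserves (suc (suc (suc (suc (suc zero))))) zero = trans (adj-sym d x) xd
    preserves (suc (suc (suc (suc (suc zero))))) (suc zero) = trans (adj-sym d y) yd
    preserves (suc (suc (suc (suc (suc zero))))) (suc (suc zero)) = trans (adj-sym d a) ad
    preserves (suc (suc (suc (suc (suc zero))))) (suc (suc (suc zero))) = trans (adj-sym d b) bd
    preserves (suc (suc (suc (suc (suc zero))))) (suc (suc (suc (suc zero)))) = trans (adj-sym d c) cd
    preserves (suc (suc (suc (suc (suc zero))))) (suc (suc (suc (suc (suc zero))))) = irrefl G d

triangle : ℕ → ℕ
triangle zero    = 0
triangle (suc m) = triangle m + m

pair : ∀ m → Fin (triangle m) → Fin m × Fin m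
pair (suc m) p with splitAt (triangle m) p
... | inj₁ p′ = Product.map suc suc (pair m p′)
... | inj₂ j  = zero , suc j

pair-distinct : ∀ m p → proj₁ (pair m p) ≢ proj₂ (pair m p)
pair-distinct (suc m) p with splitAt (triangle m) p
... | inj₁ p′ = pair-distinct m p′ ∘ suc-injective
... | inj₂ j  = λ ()

pair-↑ˡ : ∀ m p → pair (suc m) (p ↑ˡ m) ≡ Product.map suc suc (pair m p)
pair-↑ˡ m p rewrite splitAt-↑ˡ (triangle m) p m = refl

pair-↑ʳ : ∀ m j → pair (suc m) (triangle m ↑ʳ j) ≡ (zero , suc j)
pair-↑ʳ m j rewrite splitAt-↑ʳ (triangle m) m j = refl

pair-covers : ∀ m {i j : Fin m} → i ≢ j → ∃[ p ] (pair m p ≡ (i , j) ⊎ pair m p ≡ (j , i))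
pair-covers (suc m) {zero}  {zero}  0≢0 = contradiction refl 0≢0
pair-covers (suc m) {zero}  {suc j} _   = triangle m ↑ʳ j , inj₁ (pair-↑ʳ m j)
pair-covers (suc m) {suc i} {zero}  _   = triangle m ↑ʳ i , inj₂ (pair-↑ʳ m i)
pair-covers (suc m) {suc i} {suc j} i≢j with pair-covers m (i≢j ∘ cong suc)
... | p , eq = p ↑ˡ m , Sum.map lift lift eq
  where
  lift : ∀ {e} → pair m p ≡ e → pair (suc m) (p ↑ˡ m) ≡ Product.map suc suc e
  lift = trans (pair-↑ˡ m p) ∘ cong (Product.map suc suc)

triangle-double : ∀ m → 2 * triangle m + m ≡ m * m
triangle-double zero    = refl
triangle-double (suc m) = begin
  2 * (triangle m + m) + suc m       ≡⟨ regroup (triangle m) m ⟩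
  (2 * triangle m + m) + (2 * m + 1) ≡⟨ cong (_+ (2 * m + 1)) (triangle-double m) ⟩
  m * m + (2 * m + 1)                ≡⟨ square-suc m ⟩
  suc m * suc m                      ∎
  where
  open ≡-Reasoning
  regroup : ∀ t m → 2 * (t + m) + suc m ≡ (2 * t + m) + (2 * m + 1)
  regroup = solve-∀
  square-suc : ∀ m → m * m + (2 * m + 1) ≡ suc m * suc m
  square-suc = solve-∀

bound≡ : ∀ ω → bound ω ≡ triangle ω * ω + ω
bound≡ ω = begin
  (ω ^ 3 ∸ ω ^ 2 + 2 * ω) / 2                ≡⟨ cong (λ x → (x ∸ ω ^ 2 + 2 * ω) / 2) cube ⟩
  (2 * (t * ω) + ω ^ 2 ∸ ω ^ 2 + 2 * ω) / 2  ≡⟨ cong (λ x → (x + 2 * ω) / 2) (m+n∸n≡m _ (ω ^ 2)) ⟩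
  (2 * (t * ω) + 2 * ω) / 2                  ≡⟨ cong (_/ 2) (double (t * ω) ω) ⟩
  (t * ω + ω) * 2 / 2                        ≡⟨ m*n/n≡m (t * ω + ω) 2 ⟩
  t * ω + ω                                  ∎
  where
  open ≡-Reasoning
  t : ℕ
  t = triangle ω
  -- The solver does not reflect _^_, so w ^ 2 and w ^ 3 appear in their unfolded forms.
  cube-reassoc : ∀ w → w * (w * (w * 1)) ≡ w * w * w
  cube-reassoc = solve-∀
  cube-expand : ∀ t w → (2 * t + w) * w ≡ 2 * (t * w) + w * (w * 1)
  cube-expand = solve-∀
  cube : ω ^ 3 ≡ 2 * (t * ω) + ω ^ 2
  cube = begin
    ω ^ 3            ≡⟨ cube-reassoc ω ⟩
    ω * ω * ω        ≡⟨ cong (_* ω) (sym (triangle-double ω)) ⟩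
    (2 * t + ω) * ω  ≡⟨ cube-expand t ω ⟩
    2 * (t * ω) + ω ^ 2 ∎
  double : ∀ x y → 2 * x + 2 * y ≡ (x + y) * 2
  double = solve-∀

module MaximumClique {n} {G : Graph n} (free : P2∪P4-free G) {ω} {K : Fin ω → Fin n}
                     (K-clique : IsClique G K) (maximum : ¬ HasClique G (suc ω)) where

  Misses : Fin ω × Fin ω → Fin n → Set
  Misses e v = adj G (K (proj₁ e)) v ≡ false × adj G (K (proj₂ e)) v ≡ false

  misses? : ∀ e v → Dec (Misses e v)
  misses? e v = (adj G (K (proj₁ e)) v ≟ᵇ false) ×-dec (adj G (K (proj₂ e)) v ≟ᵇ false)

  missed-by : Fin (triangle ω) → List (Fin n)
  missed-by p = filter (misses? (pair ω p)) (allFin n)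

  missed-by-P4-free : ∀ p → P4-free G (missed-by p)
  missed-by-P4-free p a∈ b∈ c∈ d∈ p4 =
    free (P2∪P4-induced G (K-clique _ _ (pair-distinct ω p)) (far a∈ ∷ far b∈ ∷ far c∈ ∷ far d∈ ∷ []) p4)
    where
    far : ∀ {w} → w ∈ missed-by p → Misses (pair ω p) w
    far w∈ = proj₂ (∈-filter⁻ (misses? (pair ω p)) {xs = allFin n} w∈)

  χ : ∀ p → OptimalColouring G (missed-by p)
  χ p = cograph-colouring G (unique-filter (misses? (pair ω p)) (allFin⁺ n)) (missed-by-P4-free p)
          (On.wellFounded length <-wellFounded _)

  χ-colours≤ω : ∀ p → OptimalColouring.colours (χ p) ≤ ω
  χ-colours≤ω p = clique-size-≤ G maximum (OptimalColouring.clique-isClique (χ p))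

  NeverMissed : Fin n → Set
  NeverMissed v = ¬ (∃[ p ] Misses (pair ω p) v)

  misses-some-pair : ∀ {v i j} → i ≢ j → adj G (K i) v ≡ false → adj G (K j) v ≡ false →
    ∃[ p ] Misses (pair ω p) v
  misses-some-pair {v} i≢j Kiv Kjv with pair-covers ω i≢j
  ... | p , inj₁ eq = p , subst (λ e → Misses e v) (sym eq) (Kiv , Kjv)
  ... | p , inj₂ eq = p , subst (λ e → Misses e v) (sym eq) (Kjv , Kiv)

  adjacent-to-all-but : ∀ {v i} → NeverMissed v → adj G (K i) v ≡ false → ∀ j → j ≢ i → adj G v (K j) ≡ true
  adjacent-to-all-but {v} {i} never Kiv j j≢i = decidable-stable (adj G v (K j) ≟ᵇ true) λ vKj≢true →
    never (misses-some-pair j≢i (trans (adj-sym G (K j) v) (¬-not vKj≢true)) Kiv)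

  data Class (v : Fin n) : Set where
    missed        : ∀ p → v ∈ missed-by p → Class v
    non-neighbour : ∀ i → adj G (K i) v ≡ false → NeverMissed v → Class v

  classify : ∀ v → Class v
  classify v with any? (λ p → misses? (pair ω p) v)
  ... | yes (p , m) = missed p (∈-filter⁺ (misses? (pair ω p)) (∈-allFin v) m)
  ... | no never with any? (λ i → adj G (K i) v ≟ᵇ false)
  ...   | yes (i , Kiv) = non-neighbour i Kiv never
  ...   | no adjacent-to-all = contradiction (clique⇒HasClique G (∷-clique G K-clique v~K)) maximum
    where
    v~K : ∀ i → adj G v (K i) ≡ true
    v~K i = trans (adj-sym G v (K i)) (¬-not (adjacent-to-all ∘ (i ,_)))

  χ-colour : ∀ p {v} → v ∈ missed-by p → Fin ω
  χ-colour p v∈ = inject≤ (OptimalColouring.colour (χ p) v∈) (χ-colours≤ω p)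

  -- Takes p ≡ q as an argument: matching it against refl inside proper makes Agda
  -- unfold the colourings χ p, which is prohibitively expensive.
  χ-proper : ∀ {p q u v} → p ≡ q → (u∈ : u ∈ missed-by p) (v∈ : v ∈ missed-by q) → adj G u v ≡ true →
    χ-colour p u∈ ≢ χ-colour q v∈
  χ-proper {p} refl u∈ v∈ uv = OptimalColouring.proper (χ p) u∈ v∈ uv ∘ inject≤-injective _ _ _ _

  palette : ℕ
  palette = triangle ω * ω + ω

  colour : ∀ {v} → Class v → Fin palette
  colour (missed p v∈)          = combine p (χ-colour p v∈) ↑ˡ ω
  colour (non-neighbour i _ _) = (triangle ω * ω) ↑ʳ i

  proper : ∀ {u v} (cu : Class u) (cv : Class v) → adj G u v ≡ true → colour cu ≢ colour cv
  proper (missed p u∈) (missed q v∈) uv eq =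
    let p≡q , same = combine-injective p (χ-colour p u∈) q (χ-colour q v∈) (↑ˡ-injective ω _ _ eq)
    in χ-proper p≡q u∈ v∈ uv same
  proper (missed _ _) (non-neighbour _ _ _) _ = ↑ˡ≢↑ʳ _ _
  proper (non-neighbour _ _ _) (missed _ _) _ = ↑ˡ≢↑ʳ _ _ ∘ sym
  proper (non-neighbour i Kiu u-never) (non-neighbour j Kjv v-never) uv eq
    with ↑ʳ-injective (triangle ω * ω) i j eq
  ... | refl = maximum (replace-by-edge G K-clique i uv
                 (adjacent-to-all-but u-never Kiu) (adjacent-to-all-but v-never Kjv))

  colouring : Colouring G palette
  colouring = (λ v → colour (classify v)) , λ u v uv → proper (classify u) (classify v) uv

corollary4p4 : ∀ {n} (G : Graph n) (ω : ℕ) →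
    P2∪P4-free G → CliqueNumber G ω → χ≤ G (bound ω)
corollary4p4 G ω free ((K , _ , K-clique) , maximum) =
  subst (Colouring G) (sym (bound≡ ω)) (MaximumClique.colouring {G = G} free {K = K} K-clique maximum)
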